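{- Let $G$ be a finite, simple, connected graph with no induced house and no induced hole, and let $uv$ be an edge of $G$. Then for every vertex $z$ not in the line $\overline{uv}$, there exists a common neighbour $w$ of $u$ and $v$ that lies on a shortest path from $z$ to $u$ and on a shortest path from $z$ to $v$ (i.e. $w\in I(z,u)\cap I(z,v)$).
   Context: The house is a 5-cycle plus one chord; a hole is a cycle on at least five vertices. $d_G$ is the shortest-path distance. A vertex $z$ is between $u$ and $v$ if $d_G(u,v)=d_G(u,z)+d_G(z,v)$; $I(u,v)$ is the set of such vertices. For distinct vertices $u,v$, the line $\overline{uv}$ is the set of all vertices $z$ such that one of $u,v,z$ is between the other two. -}

module Defs where

open import Data.Nat using (ℕ; zero; suc; _+_; _≤_; _≡ᵇ_)
open import Data.Fin using (Fin; toℕ)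
open import Data.Bool using (Bool; true; false; T; _∨_; _∧_)
open import Data.Product using (Σ; ∃; _×_; _,_)
open import Data.Sum using (_⊎_)
open import Function.Definitions using (Injective)
open import Relation.Binary.PropositionalEquality using (_≡_)
open import Relation.Nullary using (¬_)

record Graph (n : ℕ) : Set where
  field
    adj    : Fin n → Fin n → Bool
    sym    : ∀ u v → adj u v ≡ adj v u
    irrefl : ∀ u → adj u u ≡ false

module _ {n : ℕ} (G : Graph n) where
  open Graph G

  Adj : Fin n → Fin n → Set
  Adj u v = T (adj u v)

  data Walk : Fin n → Fin n → ℕ → Set where
    [] : ∀ {u} → Walk u u zero
    _∷_ : ∀ {u v w k} → Adj u v → Walk v w k → Walk u w (suc k)

  Connected : Set
  Connected = ∀ u v → ∃ λ k → Walk u v k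

  Dist : Fin n → Fin n → ℕ → Set
  Dist u v k = Walk u v k × (∀ m → Walk u v m → k ≤ m)

  Between : Fin n → Fin n → Fin n → Set
  Between u z v = Σ ℕ λ a → Σ ℕ λ b → Σ ℕ λ c →
    Dist u z a × Dist z v b × Dist u v c × c ≡ a + b

  _∈I[_,_] : Fin n → Fin n → Fin n → Set
  z ∈I[ u , v ] = Between u z v

  OnLine : Fin n → Fin n → Fin n → Set
  OnLine u v z = Between u z v ⊎ Between z u v ⊎ Between u v z

  InducedCopy : (k : ℕ) → (Fin k → Fin k → Bool) → Set
  InducedCopy k H = Σ (Fin k → Fin n) λ f →
    Injective _≡_ _≡_ f × (∀ i j → adj (f i) (f j) ≡ H i j)

cycleAdj : (k : ℕ) → Fin k → Fin k → Bool
cycleAdj k i j =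
  (suc (toℕ i) ≡ᵇ toℕ j) ∨ (suc (toℕ j) ≡ᵇ toℕ i)
  ∨ ((suc (toℕ i) ≡ᵇ k) ∧ (toℕ j ≡ᵇ 0))
  ∨ ((suc (toℕ j) ≡ᵇ k) ∧ (toℕ i ≡ᵇ 0))

houseAdj : Fin 5 → Fin 5 → Bool
houseAdj i j = cycleAdj 5 i j ∨ ((toℕ i ≡ᵇ 0) ∧ (toℕ j ≡ᵇ 2)) ∨ ((toℕ i ≡ᵇ 2) ∧ (toℕ j ≡ᵇ 0))

module _ {n : ℕ} (G : Graph n) where

  HouseFree : Set
  HouseFree = ¬ InducedCopy G 5 houseAdj

  HoleFree : Set
  HoleFree = ∀ k → 5 ≤ k → ¬ InducedCopy G k (cycleAdj k)

module Submission where

-- Fix z and write ℓ(x) = d(x,z) for the level of a vertex.  An edge uv with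
-- z off the line uv must have ℓ(u) = ℓ(v) = k+1 (otherwise z ∈ I(u,v), or one
-- endpoint lies between z and the other), and then every common neighbour
-- at level k lies in I(z,u) ∩ I(z,v).  So the heart of the proof is:
--
--   (common descent)  adjacent vertices u, v on the same positive level k+1
--   have a common neighbour on level k.
--
-- Take neighbours a of u and b of v on level k.  If a ~ v or b ~ u we are done.
-- If a ~ b, induction gives a common neighbour c of a, b on level k-1, and
-- c,a,u,v,b is an induced house.  Otherwise a-u-v-b is an induced path whose
-- ends lie on level k and whose interior lies above it: a "ladder".  A ladder
-- never exists in a hole-free graph: descend from both ends by one level; the
-- new vertices either close the path into a hole or extend it to a ladder one
-- level lower, and at level 0 both ends would coincide with z.

open import Defs
open import Data.Nat using (ℕ; zero; suc; _+_; _≤_; _<_; z≤n; s≤s; _≡ᵇ_; _≤?_)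
open import Data.Nat.Properties
open import Data.Fin using (Fin; toℕ; fromℕ<; zero; suc)
open import Data.Fin.Properties using (any?; all?; toℕ-injective; toℕ<n; toℕ-fromℕ<)
  renaming (_≟_ to _≟ᶠ_)
open import Data.Bool using (Bool; true; false; T)
open import Data.Bool.Properties using (T-∨; T-∧) renaming (_≟_ to _≟ᵇ_)
open import Data.Product using (Σ; _×_; _,_; proj₁; proj₂)
open import Data.Product.Function.NonDependent.Propositional using (_×-⇔_)
open import Data.Sum using (_⊎_; inj₁; inj₂)
open import Data.Sum.Function.Propositional using (_⊎-⇔_)
open import Data.Empty using (⊥; ⊥-elim)
open import Function using (_∘_)
open import Function.Bundles using (_⇔_; mk⇔; Equivalence)
open import Function.Definitions using (Injective)
import Function.Properties.Equivalence as ⇔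
open import Relation.Binary using (tri<; tri≈; tri>)
open import Relation.Binary.PropositionalEquality
open import Relation.Nullary using (¬_; Dec; yes; no)
open import Relation.Nullary.Decidable using (T?; map′; from-yes; _×-dec_; _→-dec_)
open import Relation.Unary using (Decidable)

-- Least number principle: a decidable predicate on ℕ with a witness has a
-- least witness.  This turns "there is a walk" into "there is a distance".
module _ {P : ℕ → Set} (P? : Decidable P) where

  private
    leastBelow : ∀ k → (Σ ℕ λ m → P m × (∀ j → P j → m ≤ j)) ⊎ (∀ j → j < k → ¬ P j)
    leastBelow zero = inj₂ (λ _ ())
    leastBelow (suc k) with leastBelow k | P? k
    ... | inj₁ least | _ = inj₁ least
    ... | inj₂ none | yes pk = inj₁ (k , pk , λ j pj → ≮⇒≥ (λ j<k → none j j<k pj))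
    ... | inj₂ none | no ¬pk = inj₂ below
      where
      below : ∀ j → j < suc k → ¬ P j
      below j (s≤s j≤k) with m≤n⇒m<n∨m≡n j≤k
      ... | inj₁ j<k = none j j<k
      ... | inj₂ refl = ¬pk

  leastWitness : ∀ {k} → P k → Σ ℕ λ m → P m × (∀ j → P j → m ≤ j)
  leastWitness {k} pk with leastBelow (suc k)
  ... | inj₁ least = least
  ... | inj₂ none = ⊥-elim (none k ≤-refl pk)

T-⇔⇒≡ : ∀ {a b} → (T a ⇔ T b) → a ≡ b
T-⇔⇒≡ {false} {false} _ = refl
T-⇔⇒≡ {false} {true}  e = ⊥-elim (Equivalence.from e _)
T-⇔⇒≡ {true}  {false} e = ⊥-elim (Equivalence.to e _)
T-⇔⇒≡ {true}  {true}  _ = refl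

T-≡ᵇ : ∀ {m n} → T (m ≡ᵇ n) ⇔ (m ≡ n)
T-≡ᵇ = mk⇔ (≡ᵇ⇒≡ _ _) (≡⇒≡ᵇ _ _)

CycAdj : ℕ → ℕ → ℕ → Set
CycAdj m p q = suc p ≡ q ⊎ suc q ≡ p ⊎ (suc p ≡ m × q ≡ 0) ⊎ (suc q ≡ m × p ≡ 0)

cycleAdj-spec : ∀ m (i j : Fin m) → T (cycleAdj m i j) ⇔ CycAdj m (toℕ i) (toℕ j)
cycleAdj-spec m i j =
  ⇔.trans T-∨ (T-≡ᵇ ⊎-⇔ ⇔.trans T-∨ (T-≡ᵇ ⊎-⇔ ⇔.trans T-∨
    (⇔.trans T-∧ (T-≡ᵇ ×-⇔ T-≡ᵇ) ⊎-⇔ ⇔.trans T-∧ (T-≡ᵇ ×-⇔ T-≡ᵇ))))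

CycAdj-sym : ∀ {m p q} → CycAdj m p q → CycAdj m q p
CycAdj-sym (inj₁ e) = inj₂ (inj₁ e)
CycAdj-sym (inj₂ (inj₁ e)) = inj₁ e
CycAdj-sym (inj₂ (inj₂ (inj₁ e))) = inj₂ (inj₂ (inj₂ e))
CycAdj-sym (inj₂ (inj₂ (inj₂ e))) = inj₂ (inj₂ (inj₁ e))

CycAdj-irrefl : ∀ {k p} → ¬ CycAdj (5 + k) p p
CycAdj-irrefl (inj₁ e) = 1+n≢n e
CycAdj-irrefl (inj₂ (inj₁ e)) = 1+n≢n e
CycAdj-irrefl (inj₂ (inj₂ (inj₁ (() , refl))))
CycAdj-irrefl (inj₂ (inj₂ (inj₂ (() , refl))))

-- In a cycle of length at least 5, any two vertices p < q are separated by a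
-- neighbour l of p that is not a neighbour of q.  (This fails for C₄.)
cycle-separating : ∀ k {p q} → p < q → q < 5 + k →
  Σ ℕ λ l → l < 5 + k × CycAdj (5 + k) p l × ¬ CycAdj (5 + k) q l
cycle-separating k {zero} {q@(suc _)} _ _ with q ≟ 2
... | no q≢2 = 1 , s≤s (s≤s z≤n) , inj₁ refl , notAdj
  where
  notAdj : ¬ CycAdj (5 + k) q 1
  notAdj (inj₁ ())
  notAdj (inj₂ (inj₁ e)) = q≢2 (sym e)
  notAdj (inj₂ (inj₂ (inj₁ (_ , ()))))
  notAdj (inj₂ (inj₂ (inj₂ (() , _))))
... | yes refl = 4 + k , ≤-refl , inj₂ (inj₂ (inj₂ (refl , refl))) , notAdj
  where
  notAdj : ¬ CycAdj (5 + k) 2 (4 + k)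
  notAdj (inj₁ ())
  notAdj (inj₂ (inj₁ ()))
  notAdj (inj₂ (inj₂ (inj₁ (() , _))))
  notAdj (inj₂ (inj₂ (inj₂ (_ , ()))))
cycle-separating k {suc zero} {q} p<q _ with q ≟ 4 + k
... | yes refl = 2 , s≤s (s≤s (s≤s z≤n)) , inj₁ refl , notAdj
  where
  notAdj : ¬ CycAdj (5 + k) (4 + k) 2
  notAdj (inj₁ ())
  notAdj (inj₂ (inj₁ ()))
  notAdj (inj₂ (inj₂ (inj₁ (_ , ()))))
  notAdj (inj₂ (inj₂ (inj₂ (() , _))))
... | no q≢last = 0 , s≤s z≤n , inj₂ (inj₁ refl) , notAdj
  where
  notAdj : ¬ CycAdj (5 + k) q 0
  notAdj (inj₁ ())
  notAdj (inj₂ (inj₁ e)) = <⇒≢ p<q e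
  notAdj (inj₂ (inj₂ (inj₁ (e , _)))) = q≢last (suc-injective e)
  notAdj (inj₂ (inj₂ (inj₂ (() , _))))
cycle-separating k {suc (suc p)} {q} p<q q<m =
  suc p , <-trans (n<1+n _) (<-trans p<q q<m) , inj₂ (inj₁ refl) , notAdj
  where
  notAdj : ¬ CycAdj (5 + k) q (suc p)
  notAdj (inj₁ e) = <-asym (<-trans (n<1+n _) p<q) (≤-reflexive e)
  notAdj (inj₂ (inj₁ e)) = <-irrefl e p<q
  notAdj (inj₂ (inj₂ (inj₁ (_ , ()))))
  notAdj (inj₂ (inj₂ (inj₂ (_ , refl)))) = n≮0 p<q

_◁_ : ∀ {n} → Fin n → (ℕ → Fin n) → ℕ → Fin n
(x ◁ P) zero = x
(x ◁ P) (suc p) = P p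

_▷[_]_ : ∀ {n} → (ℕ → Fin n) → ℕ → Fin n → ℕ → Fin n
(P ▷[ L ] y) p with p ≤? L
... | yes _ = P p
... | no _ = y

▷-before : ∀ {n} (P : ℕ → Fin n) {L y p} → p ≤ L → (P ▷[ L ] y) p ≡ P p
▷-before P {L} {p = p} p≤L with p ≤? L
... | yes _ = refl
... | no p≰L = ⊥-elim (p≰L p≤L)

▷-last : ∀ {n} (P : ℕ → Fin n) {L y} → (P ▷[ L ] y) (suc L) ≡ y
▷-last P {L} with suc L ≤? L
... | yes sL≤L = ⊥-elim (<-irrefl refl sL≤L)
... | no _ = refl

module Basics {n : ℕ} (G : Graph n) where
  open Graph G using (adj; irrefl) renaming (sym to adj-sym)

  adjacent-sym : ∀ {x y} → Adj G x y → Adj G y x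
  adjacent-sym {x} {y} = subst T (adj-sym x y)

  adjacent-irrefl : ∀ {x} → ¬ Adj G x x
  adjacent-irrefl {x} = subst T (irrefl x)

  _∷ʳ_ : ∀ {x y w k} → Walk G x y k → Adj G y w → Walk G x w (suc k)
  [] ∷ʳ e = e ∷ []
  (f ∷ p) ∷ʳ e = f ∷ (p ∷ʳ e)

  reverse : ∀ {x y k} → Walk G x y k → Walk G y x k
  reverse [] = []
  reverse (e ∷ p) = reverse p ∷ʳ adjacent-sym e

  walk? : ∀ m x y → Dec (Walk G x y m)
  walk? zero x y = map′ (λ { refl → [] }) (λ { [] → refl }) (x ≟ᶠ y)
  walk? (suc m) x y =
    map′ (λ (w , e , p) → e ∷ p) (λ { (_∷_ {v = w} e p) → w , e , p })
         (any? λ w → T? (adj x w) ×-dec walk? m w y)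

  distance : ∀ {x y k} → Walk G x y k → Σ ℕ (Dist G x y)
  distance {x} {y} p = leastWitness (λ m → walk? m x y) p

  dist-reverse : ∀ {x y k} → Dist G x y k → Dist G y x k
  dist-reverse (p , shortest) = reverse p , λ m q → shortest m (reverse q)

  dist-self : ∀ {x} → Dist G x x 0
  dist-self = [] , λ _ _ → z≤n

  dist-edge : ∀ {x y} → Adj G x y → Dist G x y 1
  dist-edge {x} {y} e = e ∷ [] , atLeastOne
    where
    atLeastOne : ∀ m → Walk G x y m → 1 ≤ m
    atLeastOne zero [] = ⊥-elim (adjacent-irrefl e)
    atLeastOne (suc m) _ = s≤s z≤n

  -- A pattern H is twin-free when distinct vertices have distinct rows.  An
  -- adjacency-preserving map from a twin-free pattern is then automatically
  -- injective, so it is an induced copy.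
  TwinFree : ∀ {k} → (Fin k → Fin k → Bool) → Set
  TwinFree {k} H = ∀ i j → (∀ l → H i l ≡ H j l) → i ≡ j

  inducedCopy : ∀ {k} {H : Fin k → Fin k → Bool} → TwinFree H → (f : Fin k → Fin n) →
    (∀ i j → adj (f i) (f j) ≡ H i j) → InducedCopy G k H
  inducedCopy {H = H} twinFree f preserves = f , injective , preserves
    where
    injective : Injective _≡_ _≡_ f
    injective {i} {j} fi≡fj = twinFree i j λ l → begin
      H i l           ≡⟨ sym (preserves i l) ⟩
      adj (f i) (f l) ≡⟨ cong (λ x → adj x (f l)) fi≡fj ⟩
      adj (f j) (f l) ≡⟨ preserves j l ⟩
      H j l           ∎
      where open ≡-Reasoning

  cycle-rowsDiffer : ∀ k (i j : Fin (5 + k)) → toℕ i < toℕ j →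
    ¬ (∀ l → cycleAdj (5 + k) i l ≡ cycleAdj (5 + k) j l)
  cycle-rowsDiffer k i j i<j sameRow with cycle-separating k i<j (toℕ<n j)
  ... | l , l<m , adjI , ¬adjJ = ¬adjJ (subst (CycAdj (5 + k) (toℕ j)) (toℕ-fromℕ< l<m) adjJ)
    where
    l′ : Fin (5 + k)
    l′ = fromℕ< l<m
    adjJ : CycAdj (5 + k) (toℕ j) (toℕ l′)
    adjJ = Equivalence.to (cycleAdj-spec _ j l′) (subst T (sameRow l′)
      (Equivalence.from (cycleAdj-spec _ i l′)
        (subst (CycAdj (5 + k) (toℕ i)) (sym (toℕ-fromℕ< l<m)) adjI)))

  cycle-twinFree : ∀ k → TwinFree (cycleAdj (5 + k))
  cycle-twinFree k i j sameRow with <-cmp (toℕ i) (toℕ j)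
  ... | tri< i<j _ _ = ⊥-elim (cycle-rowsDiffer k i j i<j sameRow)
  ... | tri≈ _ e _ = toℕ-injective e
  ... | tri> _ _ j<i = ⊥-elim (cycle-rowsDiffer k j i j<i (sym ∘ sameRow))

  house-twinFree : TwinFree houseAdj
  house-twinFree =
    from-yes (all? λ i → all? λ j → all? (λ l → houseAdj i l ≟ᵇ houseAdj j l) →-dec i ≟ᶠ j)

  -- A sequence P₀…P_L in which consecutive vertices are adjacent and no other
  -- pair is, except possibly the two ends: a cycle when the ends are adjacent.
  record ChordlessPath (L : ℕ) (P : ℕ → Fin n) : Set where
    field
      step    : ∀ p → p < L → Adj G (P p) (P (suc p))
      noChord : ∀ p q → suc p < q → q ≤ L → 0 < p ⊎ q < L → ¬ Adj G (P p) (P q)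

  record InducedPath (L : ℕ) (P : ℕ → Fin n) : Set where
    field
      step    : ∀ p → p < L → Adj G (P p) (P (suc p))
      noChord : ∀ p q → suc p < q → q ≤ L → ¬ Adj G (P p) (P q)

  closePath : ∀ {L P} → ChordlessPath L P → ¬ Adj G (P 0) (P L) → InducedPath L P
  closePath {L} {P} path ¬ends = record { step = ChordlessPath.step path ; noChord = noChord }
    where
    noChord : ∀ p q → suc p < q → q ≤ L → ¬ Adj G (P p) (P q)
    noChord (suc p) q h q≤L = ChordlessPath.noChord path (suc p) q h q≤L (inj₁ (s≤s z≤n))
    noChord zero q h q≤L with m≤n⇒m<n∨m≡n q≤L
    ... | inj₁ q<L = ChordlessPath.noChord path zero q h q≤L (inj₂ q<L)
    ... | inj₂ refl = ¬ends

  prepend : ∀ {L P x} → InducedPath L P → Adj G x (P 0) →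
    (∀ p → 0 < p → p < L → ¬ Adj G x (P p)) → ChordlessPath (suc L) (x ◁ P)
  prepend {L} {P} {x} path x~P₀ x≁interior = record { step = step ; noChord = noChord }
    where
    step : ∀ p → p < suc L → Adj G ((x ◁ P) p) ((x ◁ P) (suc p))
    step zero _ = x~P₀
    step (suc p) (s≤s p<L) = InducedPath.step path p p<L
    noChord : ∀ p q → suc p < q → q ≤ suc L → 0 < p ⊎ q < suc L → ¬ Adj G ((x ◁ P) p) ((x ◁ P) q)
    noChord zero (suc q) (s≤s 0<q) _ (inj₂ (s≤s q<L)) = x≁interior q 0<q q<L
    noChord (suc p) (suc q) (s≤s h) (s≤s q≤L) _ = InducedPath.noChord path p q h q≤L

  append : ∀ {L P y} → InducedPath L P → Adj G (P L) y →
    (∀ p → 0 < p → p < L → ¬ Adj G (P p) y) → ChordlessPath (suc L) (P ▷[ L ] y)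
  append {L} {P} {y} path P_L~y interior≁y = record { step = step ; noChord = noChord }
    where
    Q = P ▷[ L ] y
    step : ∀ p → p < suc L → Adj G (Q p) (Q (suc p))
    step p (s≤s p≤L) with m≤n⇒m<n∨m≡n p≤L
    ... | inj₁ p<L rewrite ▷-before P {y = y} p≤L | ▷-before P {y = y} p<L =
      InducedPath.step path p p<L
    ... | inj₂ refl rewrite ▷-before P {y = y} p≤L | ▷-last P {p} {y} = P_L~y
    noChord : ∀ p q → suc p < q → q ≤ suc L → 0 < p ⊎ q < suc L → ¬ Adj G (Q p) (Q q)
    noChord p q h q≤sL ends with m≤n⇒m<n∨m≡n q≤sL
    ... | inj₁ (s≤s q≤L) rewrite ▷-before P {y = y} q≤L
                               | ▷-before P {y = y} (≤-trans (n≤1+n p) (<⇒≤ (≤-trans h q≤L))) =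
      InducedPath.noChord path p q h q≤L
    ... | inj₂ refl with ends
    ...   | inj₂ q<q = ⊥-elim (<-irrefl refl q<q)
    ...   | inj₁ 0<p rewrite ▷-before P {y = y} (≤-pred (<⇒≤ h)) | ▷-last P {L} {y} =
      interior≁y p 0<p (≤-pred h)

  noHole : HoleFree G → ∀ k {C} → ChordlessPath (4 + k) C → ¬ Adj G (C 0) (C (4 + k))
  noHole holeFree k {C} path wrap =
    holeFree (5 + k) (m≤m+n 5 k) (inducedCopy (cycle-twinFree k) (C ∘ toℕ) preserves)
    where
    m = 5 + k
    open ChordlessPath path
    ordered : ∀ p q → p < q → q < m → Adj G (C p) (C q) ⇔ CycAdj m p q
    ordered p q p<q (s≤s q≤last) = mk⇔ toCyc fromCyc
      where
      toCyc : Adj G (C p) (C q) → CycAdj m p q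
      toCyc a with suc p ≟ q | p ≟ 0 | q ≟ 4 + k
      ... | yes e | _ | _ = inj₁ e
      ... | no _ | yes refl | yes refl = inj₂ (inj₂ (inj₂ (refl , refl)))
      ... | no ne | yes refl | no q≢last =
        ⊥-elim (noChord p q (≤∧≢⇒< p<q ne) q≤last (inj₂ (≤∧≢⇒< q≤last q≢last)) a)
      ... | no ne | no p≢0 | _ =
        ⊥-elim (noChord p q (≤∧≢⇒< p<q ne) q≤last (inj₁ (n≢0⇒n>0 p≢0)) a)
      fromCyc : CycAdj m p q → Adj G (C p) (C q)
      fromCyc (inj₁ refl) = step p q≤last
      fromCyc (inj₂ (inj₁ refl)) = ⊥-elim (<-asym p<q (n<1+n q))
      fromCyc (inj₂ (inj₂ (inj₁ (_ , refl)))) = ⊥-elim (n≮0 p<q)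
      fromCyc (inj₂ (inj₂ (inj₂ (refl , refl)))) = wrap
    cyclic : ∀ p q → p < m → q < m → Adj G (C p) (C q) ⇔ CycAdj m p q
    cyclic p q p<m q<m with <-cmp p q
    ... | tri< p<q _ _ = ordered p q p<q q<m
    ... | tri≈ _ refl _ = mk⇔ (⊥-elim ∘ adjacent-irrefl) (⊥-elim ∘ CycAdj-irrefl)
    ... | tri> _ _ q<p = mk⇔ (CycAdj-sym ∘ Equivalence.to (ordered q p q<p p<m) ∘ adjacent-sym)
                             (adjacent-sym ∘ Equivalence.from (ordered q p q<p p<m) ∘ CycAdj-sym)
    preserves : ∀ i j → adj (C (toℕ i)) (C (toℕ j)) ≡ cycleAdj m i j
    preserves i j = T-⇔⇒≡ (⇔.trans (cyclic _ _ (toℕ<n i) (toℕ<n j)) (⇔.sym (cycleAdj-spec m i j)))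

  noHouse : HouseFree G → ∀ {a b c u v} →
    Adj G c a → Adj G c b → Adj G a b → Adj G a u → Adj G v b → Adj G u v →
    ¬ Adj G a v → ¬ Adj G b u → ¬ Adj G c u → ¬ Adj G c v → ⊥
  noHouse houseFree {a} {b} {c} {u} {v} ca cb ab au vb uv a≁v b≁u c≁u c≁v =
    houseFree (inducedCopy house-twinFree f preserves)
    where
    f : Fin 5 → Fin n
    f zero = b
    f (suc zero) = c
    f (suc (suc zero)) = a
    f (suc (suc (suc zero))) = u
    f (suc (suc (suc (suc zero)))) = v
    edge : ∀ {x y} → Adj G x y → adj x y ≡ true
    edge {x} {y} e with adj x y
    ... | true = refl
    edge′ : ∀ {x y} → Adj G y x → adj x y ≡ true
    edge′ = edge ∘ adjacent-sym
    nonEdge : ∀ {x y} → ¬ Adj G x y → adj x y ≡ false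
    nonEdge {x} {y} ne with adj x y
    ... | true = ⊥-elim (ne _)
    ... | false = refl
    nonEdge′ : ∀ {x y} → ¬ Adj G y x → adj x y ≡ false
    nonEdge′ ne = nonEdge (ne ∘ adjacent-sym)
    preserves : ∀ i j → adj (f i) (f j) ≡ houseAdj i j
    preserves zero zero = irrefl b
    preserves zero (suc zero) = edge′ cb
    preserves zero (suc (suc zero)) = edge′ ab
    preserves zero (suc (suc (suc zero))) = nonEdge b≁u
    preserves zero (suc (suc (suc (suc zero)))) = edge′ vb
    preserves (suc zero) zero = edge cb
    preserves (suc zero) (suc zero) = irrefl c
    preserves (suc zero) (suc (suc zero)) = edge ca
    preserves (suc zero) (suc (suc (suc zero))) = nonEdge c≁u
    preserves (suc zero) (suc (suc (suc (suc zero)))) = nonEdge c≁v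
    preserves (suc (suc zero)) zero = edge ab
    preserves (suc (suc zero)) (suc zero) = edge′ ca
    preserves (suc (suc zero)) (suc (suc zero)) = irrefl a
    preserves (suc (suc zero)) (suc (suc (suc zero))) = edge au
    preserves (suc (suc zero)) (suc (suc (suc (suc zero)))) = nonEdge a≁v
    preserves (suc (suc (suc zero))) zero = nonEdge′ b≁u
    preserves (suc (suc (suc zero))) (suc zero) = nonEdge′ c≁u
    preserves (suc (suc (suc zero))) (suc (suc zero)) = edge′ au
    preserves (suc (suc (suc zero))) (suc (suc (suc zero))) = irrefl u
    preserves (suc (suc (suc zero))) (suc (suc (suc (suc zero)))) = edge uv
    preserves (suc (suc (suc (suc zero)))) zero = edge vb
    preserves (suc (suc (suc (suc zero)))) (suc zero) = nonEdge′ c≁v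
    preserves (suc (suc (suc (suc zero)))) (suc (suc zero)) = nonEdge′ a≁v
    preserves (suc (suc (suc (suc zero)))) (suc (suc (suc zero))) = edge′ uv
    preserves (suc (suc (suc (suc zero)))) (suc (suc (suc (suc zero)))) = irrefl v

module Levels {n : ℕ} (G : Graph n) (connected : Connected G) (z : Fin n) where
  open Basics G

  distanceToZ : ∀ x → Σ ℕ (Dist G x z)
  distanceToZ x = distance (proj₂ (connected x z))

  level : Fin n → ℕ
  level x = proj₁ (distanceToZ x)

  level-dist : ∀ x → Dist G x z (level x)
  level-dist x = proj₂ (distanceToZ x)

  level-step : ∀ {x y} → Adj G x y → level x ≤ suc (level y)
  level-step {x} {y} e = proj₂ (level-dist x) _ (e ∷ proj₁ (level-dist y))

  level-adjacent : ∀ {x y} → Adj G x y →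
    level y ≡ level x ⊎ level x ≡ suc (level y) ⊎ level y ≡ suc (level x)
  level-adjacent {x} {y} e with <-cmp (level x) (level y)
  ... | tri≈ _ eq _ = inj₁ (sym eq)
  ... | tri< x<y _ _ = inj₂ (inj₂ (≤-antisym (level-step (adjacent-sym e)) x<y))
  ... | tri> _ _ y<x = inj₂ (inj₁ (≤-antisym (level-step e) y<x))

  below-nonadjacent : ∀ {x y} → suc (level x) < level y → ¬ Adj G x y
  below-nonadjacent x≪y e = <-irrefl refl (≤-trans x≪y (level-step (adjacent-sym e)))

  -- A vertex on a positive level has a neighbour one level down: the second
  -- vertex of a shortest walk to z.
  descend : ∀ x {j} → level x ≡ suc j → Σ (Fin n) λ y → Adj G x y × level y ≡ j
  descend x {j} eq with subst (Walk G x z) eq (proj₁ (level-dist x))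
  ... | _∷_ {v = y} e rest =
    y , e , ≤-antisym (proj₂ (level-dist y) j rest) (≤-pred (subst (_≤ suc (level y)) eq (level-step e)))

  level-zero : ∀ x → level x ≡ 0 → x ≡ z
  level-zero x eq with subst (Walk G x z) eq (proj₁ (level-dist x))
  ... | [] = refl

  descent-between : ∀ {w x k} → Adj G w x → level w ≡ k → level x ≡ suc k → _∈I[_,_] G w z x
  descent-between {w} {x} {k} e dw dx =
    k , 1 , level x , subst (Dist G z w) dw (dist-reverse (level-dist w)) , dist-edge e ,
    dist-reverse (level-dist x) , trans dx (+-comm 1 k)

module Ladders {n : ℕ} (G : Graph n) (connected : Connected G) (holeFree : HoleFree G) (z : Fin n) where
  open Basics G
  open Levels G connected z

  record Ladder (e L : ℕ) (P : ℕ → Fin n) : Set where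
    field
      path   : InducedPath L P
      long   : 3 ≤ L
      first  : level (P 0) ≡ e
      last   : level (P L) ≡ e
      raised : ∀ p → 0 < p → p < L → e < level (P p)

  ladder-above : ∀ {e L P} → Ladder e L P → ∀ p → p ≤ L → e ≤ level (P p)
  ladder-above ladder zero _ = ≤-reflexive (sym (Ladder.first ladder))
  ladder-above ladder (suc p) p≤L with m≤n⇒m<n∨m≡n p≤L
  ... | inj₁ p<L = <⇒≤ (Ladder.raised ladder (suc p) (s≤s z≤n) p<L)
  ... | inj₂ refl = ≤-reflexive (sym (Ladder.last ladder))

  under-interior : ∀ {j L P w} → Ladder (suc j) L P → level w ≡ j →
    ∀ p → 0 < p → p < L → ¬ Adj G w (P p)
  under-interior ladder dw p 0<p p<L =
    below-nonadjacent (subst (λ l → suc l < _) (sym dw) (Ladder.raised ladder p 0<p p<L))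

  closeByVertex : ∀ {j L P w} → Ladder (suc j) L P → level w ≡ j →
    Adj G w (P 0) → Adj G w (P L) → ⊥
  closeByVertex ladder dw w~first w~last with Ladder.long ladder
  ... | s≤s (s≤s (s≤s {n = k} _)) =
    noHole holeFree k (prepend (Ladder.path ladder) w~first (under-interior ladder dw)) w~last

  module Descent {j L P x y} (ladder : Ladder (suc j) L P) (dx : level x ≡ j) (dy : level y ≡ j)
    (x~first : Adj G x (P 0)) (y~last : Adj G y (P L))
    (x≁last : ¬ Adj G x (P L)) (y≁first : ¬ Adj G y (P 0)) where

    extended : ℕ → Fin n
    extended = (x ◁ P) ▷[ suc L ] y

    withX : InducedPath (suc L) (x ◁ P)
    withX = closePath (prepend (Ladder.path ladder) x~first (under-interior ladder dx)) x≁last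

    interior≁y : ∀ p → 0 < p → p < suc L → ¬ Adj G ((x ◁ P) p) y
    interior≁y (suc zero) _ _ = y≁first ∘ adjacent-sym
    interior≁y (suc (suc p)) _ (s≤s p<L) = under-interior ladder dy (suc p) (s≤s z≤n) p<L ∘ adjacent-sym

    extendedPath : ChordlessPath (2 + L) extended
    extendedPath = append withX (adjacent-sym y~last) interior≁y

    closeByEdge : Adj G x y → ⊥
    closeByEdge x~y with Ladder.long ladder
    ... | s≤s (s≤s (s≤s {n = k} _)) =
      noHole holeFree (suc k) extendedPath (subst (Adj G x) (sym (▷-last (x ◁ P) {suc L})) x~y)

    lower : ¬ Adj G x y → Ladder j (2 + L) extended
    lower x≁y = record
      { path   = closePath extendedPath (subst (¬_ ∘ Adj G x) (sym (▷-last (x ◁ P) {suc L})) x≁y)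
      ; long   = ≤-trans (Ladder.long ladder) (≤-trans (n≤1+n L) (n≤1+n (suc L)))
      ; first  = dx
      ; last   = trans (cong level (▷-last (x ◁ P) {suc L})) dy
      ; raised = raised
      }
      where
      raised : ∀ p → 0 < p → p < 2 + L → j < level (extended p)
      raised (suc p) _ (s≤s (s≤s p<sL)) rewrite ▷-before (x ◁ P) {y = y} (s≤s p<sL) =
        ladder-above ladder p p<sL

  -- At level 0 both ends equal z, so
  -- P₁ ~ P_L, a chord.  Otherwise descend from both ends: the new vertices
  -- close a hole or form a ladder one level lower.
  noLadder : ∀ e {L P} → Ladder e L P → ⊥
  noLadder zero {L} {P} ladder with Ladder.long ladder
  ... | s≤s (s≤s (s≤s _)) =
    InducedPath.noChord (Ladder.path ladder) 1 L (s≤s (s≤s (s≤s z≤n))) ≤-refl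
      (subst (Adj G (P 1)) ends-coincide (adjacent-sym (InducedPath.step (Ladder.path ladder) 0 (s≤s z≤n))))
    where
    ends-coincide : P 0 ≡ P L
    ends-coincide = trans (level-zero (P 0) (Ladder.first ladder)) (sym (level-zero (P L) (Ladder.last ladder)))
  noLadder (suc j) {L} {P} ladder
    with descend (P 0) (Ladder.first ladder) | descend (P L) (Ladder.last ladder)
  ... | x , first~x , dx | y , last~y , dy
    with T? (Graph.adj G x (P L)) | T? (Graph.adj G y (P 0)) | T? (Graph.adj G x y)
  ... | yes x~last | _ | _ = closeByVertex ladder dx (adjacent-sym first~x) x~last
  ... | no _ | yes y~first | _ = closeByVertex ladder dy y~first (adjacent-sym last~y)
  ... | no x≁last | no y≁first | yes x~y =
    Descent.closeByEdge ladder dx dy (adjacent-sym first~x) (adjacent-sym last~y) x≁last y≁first x~y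
  ... | no x≁last | no y≁first | no x≁y =
    noLadder j (Descent.lower ladder dx dy (adjacent-sym first~x) (adjacent-sym last~y) x≁last y≁first x≁y)

module CommonDescent {n : ℕ} (G : Graph n) (connected : Connected G)
  (houseFree : HouseFree G) (holeFree : HoleFree G) (z : Fin n) where
  open Basics G
  open Levels G connected z
  open Ladders G connected holeFree z

  edgeLadder : ∀ {k a b u v} → Adj G u v → level u ≡ suc k → level v ≡ suc k →
    Adj G a u → Adj G v b → level a ≡ k → level b ≡ k →
    ¬ Adj G a v → ¬ Adj G b u → ¬ Adj G a b → Ladder k 3 ((a ◁ (u ◁ λ _ → v)) ▷[ 2 ] b)
  edgeLadder {k} {a} {b} {u} {v} uv du dv au vb da db a≁v b≁u a≁b = record
    { path = closePath (append withA vb interior≁b) a≁b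
    ; long = ≤-refl
    ; first = da
    ; last = db
    ; raised = raised
    }
    where
    edgePath : InducedPath 1 (u ◁ λ _ → v)
    edgePath = record { step = step ; noChord = noChord }
      where
      step : ∀ p → p < 1 → Adj G ((u ◁ λ _ → v) p) ((u ◁ λ _ → v) (suc p))
      step zero _ = uv
      step (suc p) (s≤s ())
      noChord : ∀ p q → suc p < q → q ≤ 1 → ¬ Adj G ((u ◁ λ _ → v) p) ((u ◁ λ _ → v) q)
      noChord p (suc zero) (s≤s ()) _
      noChord p (suc (suc q)) _ (s≤s ())
    withA : InducedPath 2 (a ◁ (u ◁ λ _ → v))
    withA = closePath (prepend edgePath au λ { (suc p) _ (s≤s ()) }) a≁v
    interior≁b : ∀ p → 0 < p → p < 2 → ¬ Adj G ((a ◁ (u ◁ λ _ → v)) p) b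
    interior≁b (suc zero) _ _ = b≁u ∘ adjacent-sym
    interior≁b (suc (suc p)) _ (s≤s (s≤s ()))
    raised : ∀ p → 0 < p → p < 3 → k < level (((a ◁ (u ◁ λ _ → v)) ▷[ 2 ] b) p)
    raised (suc zero) _ _ = ≤-reflexive (sym du)
    raised (suc (suc zero)) _ _ = ≤-reflexive (sym dv)
    raised (suc (suc (suc p))) _ (s≤s (s≤s (s≤s ())))

  -- Adjacent vertices on a common positive level have a common neighbour one
  -- level down; otherwise there would be an induced house or a ladder.
  commonDescent : ∀ k {u v} → Adj G u v → level u ≡ suc k → level v ≡ suc k →
    Σ (Fin n) λ w → Adj G w u × Adj G w v × level w ≡ k
  commonDescent k {u} {v} uv du dv with descend u du | descend v dv
  ... | a , ua , da | b , vb , db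
    with T? (Graph.adj G a v) | T? (Graph.adj G b u) | T? (Graph.adj G a b)
  ... | yes av | _ | _ = a , adjacent-sym ua , av , da
  ... | no _ | yes bu | _ = b , bu , adjacent-sym vb , db
  ... | no a≁v | no b≁u | yes ab = ⊥-elim (house k da db)
    where
    -- a ~ b is impossible: a common neighbour c of a, b one level further down
    -- would complete the house c, a, u, v, b.
    house : ∀ m → level a ≡ m → level b ≡ m → ⊥
    house zero a-at-0 b-at-0 =
      adjacent-irrefl (subst (Adj G a) (trans (level-zero b b-at-0) (sym (level-zero a a-at-0))) ab)
    house (suc k′) da′ db′ with commonDescent k′ ab da′ db′
    ... | c , ca , cb , dc =
      noHouse houseFree ca cb ab (adjacent-sym ua) vb uv a≁v b≁u (farBelow du) (farBelow dv)
      where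
      -- u and v lie two levels above c.
      farBelow : ∀ {x} → level x ≡ suc k → ¬ Adj G c x
      farBelow {x} dx = below-nonadjacent (≤-reflexive (sym (begin
        level x               ≡⟨ dx ⟩
        suc k                 ≡⟨ cong suc (trans (sym da) da′) ⟩
        suc (suc k′)          ≡⟨ cong (λ l → suc (suc l)) (sym dc) ⟩
        suc (suc (level c))   ∎)))
        where open ≡-Reasoning
  ... | no a≁v | no b≁u | no a≁b =
    ⊥-elim (noLadder k (edgeLadder uv du dv (adjacent-sym ua) vb da db a≁v b≁u a≁b))

  offLine-levels : ∀ {u v} → Adj G u v → ¬ OnLine G u v z →
    Σ ℕ λ k → level u ≡ suc k × level v ≡ suc k
  offLine-levels {u} {v} uv offLine with level-adjacent uv
  ... | inj₂ (inj₁ u-above) =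
    ⊥-elim (offLine (inj₂ (inj₂ (1 , level v , level u , dist-edge uv , level-dist v ,
      level-dist u , u-above))))
  ... | inj₂ (inj₂ v-above) =
    ⊥-elim (offLine (inj₂ (inj₁ (level u , 1 , level v , dist-reverse (level-dist u) , dist-edge uv ,
      dist-reverse (level-dist v) , trans v-above (+-comm 1 (level u))))))
  ... | inj₁ same with level u in eq
  ... | suc k = k , refl , same
  ... | zero with level-zero u eq
  ...   | refl = ⊥-elim (offLine (inj₁ (0 , 1 , 1 , dist-self , dist-edge uv , dist-edge uv , refl)))

lemma3 : (n : ℕ) (G : Graph n) → Connected G → HouseFree G → HoleFree G →
    (u v : Fin n) → Adj G u v →
    (z : Fin n) → ¬ OnLine G u v z →
    Σ (Fin n) λ w → Adj G w u × Adj G w v ×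
    _∈I[_,_] G w z u × _∈I[_,_] G w z v
lemma3 n G connected houseFree holeFree u v uv z offLine =
  let (k , du , dv) = offLine-levels uv offLine
      (w , wu , wv , dw) = commonDescent k uv du dv
  in w , wu , wv , descent-between wu dw du , descent-between wv dw dv
  where
  open Levels G connected z
  open CommonDescent G connected houseFree holeFree z
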